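{- For $k\ge1$, $$W_{112\text{ - }2}(x;k)=\sum_{j=1}^k\frac{x}{(1-x^2)^j-1+x}\prod_{i=j+1}^k\frac{ix^2-1+(1-x^2)^i}{(1-x^2)^i-1+x}.$$
   Context: For $k\ge1$ let $[k]=\{1,\dots,k\}$; a $k$-ary word of length $n$ is an element of $[k]^n$. Two words are order-isomorphic if replacing the $i$-th smallest distinct letter by $i$ yields the same word. A word $w=w_1\cdots w_n$ contains the vincular pattern $112\text{ - }2$ if there are indices $p$ and $q\ge p+3$ with $w_pw_{p+1}w_{p+2}w_q$ order-isomorphic to $1122$; otherwise it avoids it. $a_{112\text{ - }2}(n,k)$ is the number of words in $[k]^n$ avoiding it (with $a(0,k)=1$), and $W_{112\text{ - }2}(x;k)=\sum_{n\ge0}a_{112\text{ - }2}(n,k)x^n$. An empty product equals $1$. -}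

module Defs where

open import Data.Nat as ℕ using (ℕ; zero; suc; _∸_; _≡ᵇ_; _<ᵇ_)
open import Data.Integer as ℤ using (ℤ; +_)
open import Data.Fin using (Fin; toℕ)
open import Data.Vec using (Vec; []; _∷_; toList)
open import Data.List as L using (List; []; _∷_; upTo; length; filter; concatMap; allFin)
open import Data.Bool using (Bool; true; false; _∧_; _∨_; not; T)
open import Relation.Nullary.Decidable using (T?)

-- All k-ary words of length n.  Letters are Fin k (values 0..k-1), an
-- order-preserving relabelling of [k] = {1,…,k}; containment of the
-- pattern only depends on the relative order of letters.
allWords : (n k : ℕ) → List (Vec (Fin k) n)
allWords zero    k = [] ∷ []
allWords (suc n) k = concatMap (λ a → L.map (a ∷_) (allWords n k)) (allFin k)

elemᵇ : ℕ → List ℕ → Bool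
elemᵇ c []       = false
elemᵇ c (d ∷ ds) = (c ≡ᵇ d) ∨ elemᵇ c ds

-- w contains 112-2 iff there are positions p, q ≥ p+3 with
-- w_p w_{p+1} w_{p+2} w_q order-isomorphic to 1122, i.e.
-- w_p = w_{p+1} < w_{p+2} = w_q.
contains112-2 : List ℕ → Bool
contains112-2 (a ∷ b ∷ c ∷ rest) =
  ((a ≡ᵇ b) ∧ (a <ᵇ c) ∧ elemᵇ c rest) ∨ contains112-2 (b ∷ c ∷ rest)
contains112-2 _ = false

avoids112-2 : ∀ {n k} → Vec (Fin k) n → Bool
avoids112-2 w = not (contains112-2 (L.map toℕ (toList w)))

a112-2 : ℕ → ℕ → ℕ
a112-2 n k = length (filter (λ w → T? (avoids112-2 w)) (allWords n k))

Series : Set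
Series = ℕ → ℤ

_⊕_ : Series → Series → Series
(f ⊕ g) n = f n ℤ.+ g n

_⊖_ : Series → Series → Series
(f ⊖ g) n = f n ℤ.- g n

_⊛_ : Series → Series → Series
(f ⊛ g) n = L.foldr ℤ._+_ (+ 0) (L.map (λ i → f i ℤ.* g (n ∸ i)) (upTo (suc n)))

infixl 6 _⊕_ _⊖_
infixl 7 _⊛_

const : ℤ → Series
const c zero    = c
const c (suc _) = + 0

𝟘 𝟙 : Series
𝟘 = const (+ 0)
𝟙 = const (+ 1)

X : Series
X 1 = + 1
X _ = + 0

_^ˢ_ : Series → ℕ → Series
f ^ˢ zero  = 𝟙
f ^ˢ suc m = f ⊛ (f ^ˢ m)

-- product ∏_{i=a}^{b} F i (empty product = 1 when b < a)
prodFrom : ℕ → ℕ → (ℕ → Series) → Series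
prodFrom a b F = L.foldr _⊛_ 𝟙 (L.map (λ t → F (a ℕ.+ t)) (upTo (suc b ∸ a)))

sumFrom : ℕ → ℕ → (ℕ → Series) → Series
sumFrom a b F = L.foldr _⊕_ 𝟘 (L.map (λ t → F (a ℕ.+ t)) (upTo (suc b ∸ a)))

W112-2 : ℕ → Series
W112-2 k n = + (a112-2 n k)

D : ℕ → Series
D i = ((𝟙 ⊖ X ^ˢ 2) ^ˢ i) ⊖ 𝟙 ⊕ X

N : ℕ → Series
N i = const (+ i) ⊛ X ^ˢ 2 ⊖ 𝟙 ⊕ ((𝟙 ⊖ X ^ˢ 2) ^ˢ i)

-- Write K = k + 1, A = W(x;K), A′ = W(x;k), and let R_c be the generating function of the
-- K-ary avoiders that begin with the letter c (counted by the length of the rest).  Prepending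
-- c to an avoider x y w creates an occurrence only if x = c < y, and then c c y w avoids iff
-- w avoids and does not contain y; words avoiding one letter are k-ary words, so summing over
-- x and y gives R_c + x² Σ_{y>c} R_y = A + x² Σ_{y>c} A′.  Differencing in c yields
-- R_c − A′ = (1−x²)(R_{c+1} − A′), and R_k = A, so R_c − A′ = (1−x²)^{k−c} (A − A′).
-- Summing A = 1 + x Σ_c R_c over this geometric progression gives A·D_K = x + N_K·A′, and
-- the product formula follows by induction on k, starting from W(x;0) = 1.

{-# OPTIONS --safe #-}
module Submission where

open import Defs
open import Level using (0ℓ)
open import Function using (_∘_; id)
open import Data.Bool using (Bool; true; false; not; _∧_; _∨_; if_then_else_)
open import Data.Bool.Properties using (T-≡; ¬-not)
open import Function.Bundles using (Equivalence)
open import Data.Product using (_,_)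
open import Data.Maybe using (Maybe; just; nothing)
open import Data.Fin using (toℕ)
open import Data.Vec using (toList; _∷_)
open import Data.Nat as ℕ
  using (ℕ; zero; suc; _∸_; _≤_; _<_; z≤n; s≤s; z<s; s<s; _≡ᵇ_; _<ᵇ_)
import Data.Nat.Properties as ℕ
open import Data.Nat.ListAction using (sum)
open import Data.Integer as ℤ using (ℤ; +_; _+_; _*_; -_)
import Data.Integer.Properties as ℤ
open import Data.List
  using (List; []; _∷_; _++_; [_]; foldr; map; length; filter; concatMap; upTo; applyUpTo; allFin; tabulate)
open import Data.List.Properties
  using (map-upTo; upTo-∷ʳ; map-++; foldr-∷ʳ; map-tabulate; map-cong; filter-++; length-++)
open import Data.List.Relation.Unary.All using (All; []; _∷_)
open import Data.List.Relation.Unary.All.Properties using (applyUpTo⁺₁)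
open import Relation.Nullary using (¬_; yes; no)
open import Relation.Nullary.Decidable using (T?; does)
open import Relation.Unary using (Pred; Decidable)
open import Relation.Binary.PropositionalEquality
  using (_≡_; _≢_; refl; sym; trans; cong; cong₂; subst; module ≡-Reasoning)
open import Relation.Binary.Bundles using (Setoid)
import Relation.Binary.Reasoning.Setoid as SetoidReasoning
open import Algebra.Bundles using (Monoid; CommutativeRing)
open import Algebra.Structures using (IsCommutativeRing)
open import Algebra.Consequences.Setoid using (comm∧idˡ⇒id; comm∧distrˡ⇒distr)
import Algebra.Construct.Pointwise as Pointwise
import Algebra.Solver.Ring.AlmostCommutativeRing as ACR
import Algebra.Solver.Ring

module UpToFold {c ℓ} (M : Monoid c ℓ) where

  open Monoid M renaming (refl to ≈-refl; sym to ≈-sym; trans to ≈-trans; reflexive to ≈-reflexive)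
  open SetoidReasoning setoid

  fold< : ℕ → (ℕ → Carrier) → Carrier
  fold< n F = foldr _∙_ ε (map F (upTo n))

  foldFrom : ℕ → ℕ → (ℕ → Carrier) → Carrier
  foldFrom a b F = fold< (suc b ∸ a) (λ t → F (a ℕ.+ t))

  foldr-seed : ∀ x ys → foldr _∙_ x ys ≈ foldr _∙_ ε ys ∙ x
  foldr-seed x []       = ≈-sym (identityˡ x)
  foldr-seed x (y ∷ ys) = ≈-trans (∙-congˡ (foldr-seed x ys)) (≈-sym (assoc y (foldr _∙_ ε ys) x))

  fold<-suc : ∀ n F → fold< (suc n) F ≈ fold< n F ∙ F n
  fold<-suc n F = begin
    foldr _∙_ ε (map F (upTo (suc n)))       ≡⟨ cong (foldr _∙_ ε ∘ map F) (upTo-∷ʳ n) ⟨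
    foldr _∙_ ε (map F (upTo n ++ [ n ]))    ≡⟨ cong (foldr _∙_ ε) (map-++ F (upTo n) [ n ]) ⟩
    foldr _∙_ ε (map F (upTo n) ++ [ F n ])  ≡⟨ foldr-∷ʳ _∙_ ε (F n) (map F (upTo n)) ⟩
    foldr _∙_ (F n ∙ ε) (map F (upTo n))     ≈⟨ foldr-seed (F n ∙ ε) (map F (upTo n)) ⟩
    fold< n F ∙ (F n ∙ ε)                    ≈⟨ ∙-congˡ (identityʳ (F n)) ⟩
    fold< n F ∙ F n                          ∎

  fold<-cong : ∀ n {F G} → (∀ {t} → t < n → F t ≈ G t) → fold< n F ≈ fold< n G
  fold<-cong n F≈G = foldr-map-cong (applyUpTo⁺₁ id n F≈G)
    where
    foldr-map-cong : ∀ {F G xs} → All (λ t → F t ≈ G t) xs →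
                     foldr _∙_ ε (map F xs) ≈ foldr _∙_ ε (map G xs)
    foldr-map-cong []         = ≈-refl
    foldr-map-cong (e ∷ es) = ∙-cong e (foldr-map-cong es)

  foldFrom-suc : ∀ a b F → a ≤ suc b → foldFrom a (suc b) F ≈ foldFrom a b F ∙ F (suc b)
  foldFrom-suc a b F a≤1+b = begin
    fold< (suc (suc b) ∸ a) G            ≡⟨ cong (λ n → fold< n G) (ℕ.+-∸-assoc 1 a≤1+b) ⟩
    fold< (suc (suc b ∸ a)) G            ≈⟨ fold<-suc (suc b ∸ a) G ⟩
    fold< (suc b ∸ a) G ∙ G (suc b ∸ a)
      ≡⟨ cong (λ j → fold< (suc b ∸ a) G ∙ F j) (ℕ.m+[n∸m]≡n a≤1+b) ⟩
    foldFrom a b F ∙ F (suc b)           ∎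
    where
    G : ℕ → Carrier
    G t = F (a ℕ.+ t)

  foldFrom-empty : ∀ b F → foldFrom (suc b) b F ≈ ε
  foldFrom-empty b F = ≈-reflexive (cong (λ n → fold< n (λ t → F (suc b ℕ.+ t))) (ℕ.n∸n≡0 b))

sumUpTo : ℕ → (ℕ → ℕ) → ℕ
sumUpTo zero    h = 0
sumUpTo (suc n) h = h 0 ℕ.+ sumUpTo n (h ∘ suc)

sumUpTo-cong : ∀ n {g h} → (∀ {i} → i < n → g i ≡ h i) → sumUpTo n g ≡ sumUpTo n h
sumUpTo-cong zero    g≡h = refl
sumUpTo-cong (suc n) g≡h = cong₂ ℕ._+_ (g≡h z<s) (sumUpTo-cong n (g≡h ∘ s<s))

sumUpTo-zero : ∀ n → sumUpTo n (λ _ → 0) ≡ 0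
sumUpTo-zero zero    = refl
sumUpTo-zero (suc n) = sumUpTo-zero n

sumUpTo-+ : ∀ n g h → sumUpTo n (λ i → g i ℕ.+ h i) ≡ sumUpTo n g ℕ.+ sumUpTo n h
sumUpTo-+ zero    g h = refl
sumUpTo-+ (suc n) g h =
  trans (cong (ℕ._+_ (g 0 ℕ.+ h 0)) (sumUpTo-+ n (g ∘ suc) (h ∘ suc)))
        (interchange (g 0) (h 0) (sumUpTo n (g ∘ suc)) (sumUpTo n (h ∘ suc)))
  where open import Algebra.Properties.CommutativeSemigroup ℕ.+-commutativeSemigroup using (interchange)

infixr 7 [_]·_
[_]·_ : Bool → ℕ → ℕ
[ b ]· v = if b then v else 0

sumUpTo-[]· : ∀ n b h → sumUpTo n (λ i → [ b ]· h i) ≡ [ b ]· sumUpTo n h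
sumUpTo-[]· n true  h = refl
sumUpTo-[]· n false h = sumUpTo-zero n

sumUpTo-δ : ∀ {n c} (h : ℕ → ℕ) → c < n → sumUpTo n (λ i → [ c ≡ᵇ i ]· h i) ≡ h c
sumUpTo-δ {suc n} {zero}  h _           = trans (cong (ℕ._+_ (h 0)) (sumUpTo-zero n)) (ℕ.+-identityʳ (h 0))
sumUpTo-δ {suc n} {suc c} h (s<s c<n) = sumUpTo-δ (h ∘ suc) c<n

punchIn : ℕ → ℕ → ℕ
punchIn zero    i       = suc i
punchIn (suc c) zero    = zero
punchIn (suc c) (suc i) = suc (punchIn c i)

sumUpTo-punchIn : ∀ {k c} h → c ≤ k → sumUpTo (suc k) h ≡ h c ℕ.+ sumUpTo k (h ∘ punchIn c)
sumUpTo-punchIn {k}     {zero}  h _           = refl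
sumUpTo-punchIn {suc k} {suc c} h (s≤s c≤k) =
  trans (cong (ℕ._+_ (h 0)) (sumUpTo-punchIn (h ∘ suc) c≤k))
        (x∙yz≈y∙xz (h 0) (h (suc c)) (sumUpTo k (h ∘ suc ∘ punchIn c)))
  where open import Algebra.Properties.CommutativeSemigroup ℕ.+-commutativeSemigroup using (x∙yz≈y∙xz)

sumUpTo²-δ : ∀ n {c} (T : ℕ → ℕ → ℕ) (S : ℕ → ℕ) → c < n →
  sumUpTo n (λ x → sumUpTo n (λ y → T x y ℕ.+ [ c ≡ᵇ x ]· S y))
    ≡ sumUpTo n (λ x → sumUpTo n (T x)) ℕ.+ sumUpTo n S
sumUpTo²-δ n {c} T S c<n = begin
  sumUpTo n (λ x → sumUpTo n (λ y → T x y ℕ.+ [ c ≡ᵇ x ]· S y))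
    ≡⟨ sumUpTo-cong n (λ {x} _ → trans (sumUpTo-+ n (T x) (λ y → [ c ≡ᵇ x ]· S y))
                                       (cong (ℕ._+_ (sumUpTo n (T x))) (sumUpTo-[]· n (c ≡ᵇ x) S))) ⟩
  sumUpTo n (λ x → sumUpTo n (T x) ℕ.+ [ c ≡ᵇ x ]· sumUpTo n S)
    ≡⟨ sumUpTo-+ n (λ x → sumUpTo n (T x)) (λ x → [ c ≡ᵇ x ]· sumUpTo n S) ⟩
  sumUpTo n (λ x → sumUpTo n (T x)) ℕ.+ sumUpTo n (λ x → [ c ≡ᵇ x ]· sumUpTo n S)
    ≡⟨ cong (ℕ._+_ (sumUpTo n (λ x → sumUpTo n (T x)))) (sumUpTo-δ (λ _ → sumUpTo n S) c<n) ⟩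
  sumUpTo n (λ x → sumUpTo n (T x)) ℕ.+ sumUpTo n S ∎
  where open ≡-Reasoning

[<ᵇ]·-split : ∀ c y v → [ c <ᵇ y ]· v ≡ [ suc c ≡ᵇ y ]· v ℕ.+ [ suc c <ᵇ y ]· v
[<ᵇ]·-split zero    zero          v = refl
[<ᵇ]·-split zero    (suc zero)    v = sym (ℕ.+-identityʳ v)
[<ᵇ]·-split zero    (suc (suc y)) v = refl
[<ᵇ]·-split (suc c) zero          v = refl
[<ᵇ]·-split (suc c) (suc y)       v = [<ᵇ]·-split c y v

≡ᵇ-refl : ∀ c → (c ≡ᵇ c) ≡ true
≡ᵇ-refl c = Equivalence.to T-≡ (ℕ.≡⇒≡ᵇ c c refl)

≢⇒≡ᵇ-false : ∀ {c x} → c ≢ x → (c ≡ᵇ x) ≡ false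
≢⇒≡ᵇ-false {c} {x} c≢x = ¬-not (c≢x ∘ ℕ.≡ᵇ⇒≡ c x ∘ Equivalence.from T-≡)

<⇒<ᵇ-true : ∀ {c y} → c < y → (c <ᵇ y) ≡ true
<⇒<ᵇ-true = Equivalence.to T-≡ ∘ ℕ.<⇒<ᵇ

≮⇒<ᵇ-false : ∀ {c y} → ¬ c < y → (c <ᵇ y) ≡ false
≮⇒<ᵇ-false {c} {y} c≮y = ¬-not (c≮y ∘ ℕ.<ᵇ⇒< c y ∘ Equivalence.from T-≡)

-- The commutative ring of formal power series

infix 4 _≈_
_≈_ : Series → Series → Set
f ≈ g = ∀ n → f n ≡ g n

shift : Series → Series
shift f n = f (suc n)

infixl 7 _⊙_
_⊙_ : Series → Series → Series
(f ⊙ g) zero    = f 0 * g 0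
(f ⊙ g) (suc n) = f 0 * g (suc n) + (shift f ⊙ g) n

⊛≈⊙ : ∀ f g → f ⊛ g ≈ f ⊙ g
⊛≈⊙ f g n = trans (cong (foldr _+_ (+ 0)) (map-upTo (λ i → f i * g (n ℕ.∸ i)) (suc n))) (sum≡⊙ n f)
  where
  sum≡⊙ : ∀ n f → foldr _+_ (+ 0) (applyUpTo (λ i → f i * g (n ℕ.∸ i)) (suc n)) ≡ (f ⊙ g) n
  sum≡⊙ zero    f = ℤ.+-identityʳ _
  sum≡⊙ (suc n) f = cong (_+_ (f 0 * g (suc n))) (sum≡⊙ n (shift f))

⊙-congˡ : ∀ {f f′} g → f ≈ f′ → f ⊙ g ≈ f′ ⊙ g
⊙-congˡ g f≈f′ zero    = cong (_* g 0) (f≈f′ 0)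
⊙-congˡ g f≈f′ (suc n) = cong₂ _+_ (cong (_* g (suc n)) (f≈f′ 0)) (⊙-congˡ g (f≈f′ ∘ suc) n)

⊙-congʳ : ∀ f {g g′} → g ≈ g′ → f ⊙ g ≈ f ⊙ g′
⊙-congʳ f g≈g′ zero    = cong (f 0 *_) (g≈g′ 0)
⊙-congʳ f g≈g′ (suc n) = cong₂ _+_ (cong (f 0 *_) (g≈g′ (suc n))) (⊙-congʳ (shift f) g≈g′ n)

0⊙ : ∀ g → (λ _ → + 0) ⊙ g ≈ (λ _ → + 0)
0⊙ g zero    = refl
0⊙ g (suc n) = trans (ℤ.+-identityˡ _) (0⊙ g n)

const⊙ : ∀ a g → const a ⊙ g ≈ (λ n → a * g n)
const⊙ a g zero    = refl
const⊙ a g (suc n) = trans (cong (_+_ (a * g (suc n))) (0⊙ g n)) (ℤ.+-identityʳ (a * g (suc n)))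

⊙-sucʳ : ∀ f g n → (f ⊙ g) (suc n) ≡ (f ⊙ shift g) n + f (suc n) * g 0
⊙-sucʳ f g zero    = refl
⊙-sucʳ f g (suc n) =
  trans (cong (_+_ (f 0 * g (suc (suc n)))) (⊙-sucʳ (shift f) g n))
        (sym (ℤ.+-assoc (f 0 * g (suc (suc n))) ((shift f ⊙ shift g) n) (f (suc (suc n)) * g 0)))

⊙-comm : ∀ f g → f ⊙ g ≈ g ⊙ f
⊙-comm f g zero    = ℤ.*-comm (f 0) (g 0)
⊙-comm f g (suc n) = begin
  f 0 * g (suc n) + (shift f ⊙ g) n  ≡⟨ cong₂ _+_ (ℤ.*-comm (f 0) _) (⊙-comm (shift f) g n) ⟩
  g (suc n) * f 0 + (g ⊙ shift f) n  ≡⟨ ℤ.+-comm (g (suc n) * f 0) ((g ⊙ shift f) n) ⟩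
  (g ⊙ shift f) n + g (suc n) * f 0  ≡⟨ ⊙-sucʳ g f n ⟨
  (g ⊙ f) (suc n)                    ∎
  where open ≡-Reasoning

⊙-distribˡ : ∀ f g h → f ⊙ (g ⊕ h) ≈ f ⊙ g ⊕ f ⊙ h
⊙-distribˡ f g h zero    = ℤ.*-distribˡ-+ (f 0) (g 0) (h 0)
⊙-distribˡ f g h (suc n) =
  trans (cong₂ _+_ (ℤ.*-distribˡ-+ (f 0) (g (suc n)) (h (suc n))) (⊙-distribˡ (shift f) g h n))
        (interchange (f 0 * g (suc n)) (f 0 * h (suc n)) ((shift f ⊙ g) n) ((shift f ⊙ h) n))
  where open import Algebra.Properties.CommutativeSemigroup ℤ.+-commutativeSemigroup using (interchange)

⊙-distribʳ : ∀ f g h → (f ⊕ g) ⊙ h ≈ f ⊙ h ⊕ g ⊙ h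
⊙-distribʳ f g h n =
  trans (⊙-comm (f ⊕ g) h n) (trans (⊙-distribˡ h f g n) (cong₂ _+_ (⊙-comm h f n) (⊙-comm h g n)))

⊙-scaleˡ : ∀ a f g → (λ n → a * f n) ⊙ g ≈ (λ n → a * (f ⊙ g) n)
⊙-scaleˡ a f g zero    = ℤ.*-assoc a (f 0) (g 0)
⊙-scaleˡ a f g (suc n) =
  trans (cong₂ _+_ (ℤ.*-assoc a (f 0) (g (suc n))) (⊙-scaleˡ a (shift f) g n))
        (sym (ℤ.*-distribˡ-+ a (f 0 * g (suc n)) ((shift f ⊙ g) n)))

⊙-assoc : ∀ f g h → (f ⊙ g) ⊙ h ≈ f ⊙ (g ⊙ h)
⊙-assoc f g h zero    = ℤ.*-assoc (f 0) (g 0) (h 0)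
⊙-assoc f g h (suc n) = begin
  ((f ⊙ g) ⊙ h) (suc n)
    ≡⟨ cong (λ v → a * b * c + v) (⊙-distribʳ (λ m → a * shift g m) (shift f ⊙ g) h n) ⟩
  a * b * c + (((λ m → a * shift g m) ⊙ h) n + ((shift f ⊙ g) ⊙ h) n)
    ≡⟨ cong₂ (λ u v → a * b * c + (u + v)) (⊙-scaleˡ a (shift g) h n) (⊙-assoc (shift f) g h n) ⟩
  a * b * c + (a * (shift g ⊙ h) n + (shift f ⊙ (g ⊙ h)) n)
    ≡⟨ cong (λ u → u + (a * (shift g ⊙ h) n + (shift f ⊙ (g ⊙ h)) n)) (ℤ.*-assoc a b c) ⟩
  a * (b * c) + (a * (shift g ⊙ h) n + (shift f ⊙ (g ⊙ h)) n)
    ≡⟨ ℤ.+-assoc (a * (b * c)) (a * (shift g ⊙ h) n) ((shift f ⊙ (g ⊙ h)) n) ⟨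
  (a * (b * c) + a * (shift g ⊙ h) n) + (shift f ⊙ (g ⊙ h)) n
    ≡⟨ cong (λ u → u + (shift f ⊙ (g ⊙ h)) n) (ℤ.*-distribˡ-+ a (b * c) ((shift g ⊙ h) n)) ⟨
  (f ⊙ (g ⊙ h)) (suc n) ∎
  where
  open ≡-Reasoning
  a = f 0
  b = g 0
  c = h (suc n)

neg : Series → Series
neg f n = - f n

𝟘≡0 : ∀ n → 𝟘 n ≡ + 0
𝟘≡0 zero    = refl
𝟘≡0 (suc n) = refl

≈-setoid : Setoid 0ℓ 0ℓ
≈-setoid = record
  { Carrier       = Series
  ; _≈_           = _≈_
  ; isEquivalence = record
    { refl  = λ n → refl
    ; sym   = λ f≈g n → sym (f≈g n)
    ; trans = λ f≈g g≈h n → trans (f≈g n) (g≈h n)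
    }
  }

open Setoid ≈-setoid using () renaming (refl to ≈-refl; sym to ≈-sym; trans to ≈-trans)

module ≈-Reasoning = SetoidReasoning ≈-setoid

module _ where
  open ≈-Reasoning

  ⊛-cong : ∀ {f f′ g g′} → f ≈ f′ → g ≈ g′ → f ⊛ g ≈ f′ ⊛ g′
  ⊛-cong {f} {f′} {g} {g′} f≈f′ g≈g′ = begin
    f ⊛ g    ≈⟨ ⊛≈⊙ f g ⟩
    f ⊙ g    ≈⟨ ⊙-congˡ g f≈f′ ⟩
    f′ ⊙ g   ≈⟨ ⊙-congʳ f′ g≈g′ ⟩
    f′ ⊙ g′  ≈⟨ ⊛≈⊙ f′ g′ ⟨
    f′ ⊛ g′  ∎

  ⊛-comm : ∀ f g → f ⊛ g ≈ g ⊛ f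
  ⊛-comm f g = begin
    f ⊛ g  ≈⟨ ⊛≈⊙ f g ⟩
    f ⊙ g  ≈⟨ ⊙-comm f g ⟩
    g ⊙ f  ≈⟨ ⊛≈⊙ g f ⟨
    g ⊛ f  ∎

  ⊛-assoc : ∀ f g h → (f ⊛ g) ⊛ h ≈ f ⊛ (g ⊛ h)
  ⊛-assoc f g h = begin
    (f ⊛ g) ⊛ h  ≈⟨ ⊛≈⊙ (f ⊛ g) h ⟩
    (f ⊛ g) ⊙ h  ≈⟨ ⊙-congˡ h (⊛≈⊙ f g) ⟩
    (f ⊙ g) ⊙ h  ≈⟨ ⊙-assoc f g h ⟩
    f ⊙ (g ⊙ h)  ≈⟨ ⊙-congʳ f (⊛≈⊙ g h) ⟨
    f ⊙ (g ⊛ h)  ≈⟨ ⊛≈⊙ f (g ⊛ h) ⟨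
    f ⊛ (g ⊛ h)  ∎

  ⊛-distribˡ : ∀ f g h → f ⊛ (g ⊕ h) ≈ f ⊛ g ⊕ f ⊛ h
  ⊛-distribˡ f g h = begin
    f ⊛ (g ⊕ h)    ≈⟨ ⊛≈⊙ f (g ⊕ h) ⟩
    f ⊙ (g ⊕ h)    ≈⟨ ⊙-distribˡ f g h ⟩
    f ⊙ g ⊕ f ⊙ h  ≈⟨ (λ n → cong₂ _+_ (⊛≈⊙ f g n) (⊛≈⊙ f h n)) ⟨
    f ⊛ g ⊕ f ⊛ h  ∎

  const⊛ : ∀ a g → const a ⊛ g ≈ (λ n → a * g n)
  const⊛ a g = begin
    const a ⊛ g  ≈⟨ ⊛≈⊙ (const a) g ⟩
    const a ⊙ g  ≈⟨ const⊙ a g ⟩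
    (λ n → a * g n) ∎

seriesIsCommutativeRing : IsCommutativeRing _≈_ _⊕_ _⊛_ neg 𝟘 𝟙
seriesIsCommutativeRing = record
  { isRing = record
    { +-isAbelianGroup = record
      { isGroup = record
        { isMonoid = record
          { isSemigroup = Pointwise.isSemigroup ℕ ℤ.+-isSemigroup
          ; identity    = (λ f n → trans (cong (_+ f n) (𝟘≡0 n)) (ℤ.+-identityˡ (f n)))
                        , (λ f n → trans (cong (_+_ (f n)) (𝟘≡0 n)) (ℤ.+-identityʳ (f n)))
          }
        ; inverse = (λ f n → trans (ℤ.+-inverseˡ (f n)) (sym (𝟘≡0 n)))
                  , (λ f n → trans (ℤ.+-inverseʳ (f n)) (sym (𝟘≡0 n)))
        ; ⁻¹-cong = λ f≈g n → cong -_ (f≈g n)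
        }
      ; comm = λ f g n → ℤ.+-comm (f n) (g n)
      }
    ; *-cong     = ⊛-cong
    ; *-assoc    = ⊛-assoc
    ; *-identity = comm∧idˡ⇒id ≈-setoid ⊛-comm (λ f n → trans (const⊛ (+ 1) f n) (ℤ.*-identityˡ (f n)))
    ; distrib    = comm∧distrˡ⇒distr ≈-setoid (λ f≈f′ g≈g′ n → cong₂ _+_ (f≈f′ n) (g≈g′ n))
                                     ⊛-comm ⊛-distribˡ
    }
  ; *-comm = ⊛-comm
  }

seriesCommutativeRing : CommutativeRing 0ℓ 0ℓ
seriesCommutativeRing = record { isCommutativeRing = seriesIsCommutativeRing }

open CommutativeRing seriesCommutativeRing public
  using (+-monoid; *-monoid; *-assoc; zeroˡ; zeroʳ; *-identityˡ; *-identityʳ; distribʳ; +-identityˡ; +-identityʳ)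
  renaming (+-cong to ⊕-cong; -‿cong to neg-cong)

⊖-cong : ∀ {f f′ g g′} → f ≈ f′ → g ≈ g′ → f ⊖ g ≈ f′ ⊖ g′
⊖-cong f≈f′ g≈g′ = ⊕-cong f≈f′ (neg-cong g≈g′)

constHomomorphism : ACR._-Raw-AlmostCommutative⟶_ ℤ.+-*-rawRing (ACR.fromCommutativeRing seriesCommutativeRing)
constHomomorphism = record
  { ⟦_⟧    = const
  ; +-homo = λ { a b zero → refl ; a b (suc n) → refl }
  ; *-homo = λ a b n → sym (trans (const⊛ a (const b) n) (scaled-const a b n))
  ; -‿homo = λ { a zero → refl ; a (suc n) → refl }
  ; 0-homo = λ n → refl
  ; 1-homo = λ n → refl
  }
  where
  scaled-const : ∀ a b n → a * const b n ≡ const (a * b) n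
  scaled-const a b zero    = refl
  scaled-const a b (suc n) = ℤ.*-zeroʳ a

constEq? : ∀ a b → Maybe (const a ≈ const b)
constEq? a b with a ℤ.≟ b
... | yes refl = just (λ _ → refl)
... | no  _    = nothing

open Algebra.Solver.Ring ℤ.+-*-rawRing (ACR.fromCommutativeRing seriesCommutativeRing) constHomomorphism constEq?
  using (solve; _:=_; con; _:+_; _:-_; _:*_; _:^_)

X⊛-zero : ∀ f → (X ⊛ f) 0 ≡ + 0
X⊛-zero f = ⊛≈⊙ X f 0

X⊛-suc : ∀ f n → (X ⊛ f) (suc n) ≡ f n
X⊛-suc f n = begin
  (X ⊛ f) (suc n)        ≡⟨ ⊛≈⊙ X f (suc n) ⟩
  + 0 + (shift X ⊙ f) n  ≡⟨ ℤ.+-identityˡ _ ⟩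
  (shift X ⊙ f) n        ≡⟨ ⊙-congˡ f shiftX≈𝟙 n ⟩
  (𝟙 ⊙ f) n              ≡⟨ const⊙ (+ 1) f n ⟩
  + 1 * f n              ≡⟨ ℤ.*-identityˡ (f n) ⟩
  f n                    ∎
  where
  open ≡-Reasoning
  shiftX≈𝟙 : shift X ≈ 𝟙
  shiftX≈𝟙 zero    = refl
  shiftX≈𝟙 (suc n) = refl

X²⊛≈X⊛X⊛ : ∀ f → X ^ˢ 2 ⊛ f ≈ X ⊛ (X ⊛ f)
X²⊛≈X⊛X⊛ = solve 2 (λ x f → x :^ 2 :* f := x :* (x :* f)) (λ _ → refl) X

toSeries : (ℕ → ℕ) → Series
toSeries a n = + a n

X²⊛-zero : ∀ f → (X ^ˢ 2 ⊛ f) 0 ≡ + 0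
X²⊛-zero f = trans (X²⊛≈X⊛X⊛ f 0) (X⊛-zero (X ⊛ f))

X²⊛-one : ∀ f → (X ^ˢ 2 ⊛ f) 1 ≡ + 0
X²⊛-one f = trans (X²⊛≈X⊛X⊛ f 1) (trans (X⊛-suc (X ⊛ f) 0) (X⊛-zero f))

X²⊛-suc-suc : ∀ f n → (X ^ˢ 2 ⊛ f) (suc (suc n)) ≡ f n
X²⊛-suc-suc f n = trans (X²⊛≈X⊛X⊛ f (suc (suc n))) (trans (X⊛-suc (X ⊛ f) (suc n)) (X⊛-suc f n))

toSeries-X²-recurrence : ∀ {a b c d : ℕ → ℕ} → a 0 ≡ c 0 → a 1 ≡ c 1 →
  (∀ n → a (2 ℕ.+ n) ℕ.+ b n ≡ c (2 ℕ.+ n) ℕ.+ d n) →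
  toSeries a ⊕ X ^ˢ 2 ⊛ toSeries b ≈ toSeries c ⊕ X ^ˢ 2 ⊛ toSeries d
toSeries-X²-recurrence {b = b} {d = d} a₀≡c₀ a₁≡c₁ rec zero =
  cong₂ _+_ (cong +_ a₀≡c₀) (trans (X²⊛-zero (toSeries b)) (sym (X²⊛-zero (toSeries d))))
toSeries-X²-recurrence {b = b} {d = d} a₀≡c₀ a₁≡c₁ rec (suc zero) =
  cong₂ _+_ (cong +_ a₁≡c₁) (trans (X²⊛-one (toSeries b)) (sym (X²⊛-one (toSeries d))))
toSeries-X²-recurrence {a} {b} {c} {d} a₀≡c₀ a₁≡c₁ rec (suc (suc n)) = begin
  + a (2 ℕ.+ n) + (X ^ˢ 2 ⊛ toSeries b) (2 ℕ.+ n) ≡⟨ cong (_+_ (+ a (2 ℕ.+ n))) (X²⊛-suc-suc (toSeries b) n) ⟩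
  + a (2 ℕ.+ n) + + b n                            ≡⟨ ℤ.pos-+ (a (2 ℕ.+ n)) (b n) ⟨
  + (a (2 ℕ.+ n) ℕ.+ b n)                          ≡⟨ cong +_ (rec n) ⟩
  + (c (2 ℕ.+ n) ℕ.+ d n)                          ≡⟨ ℤ.pos-+ (c (2 ℕ.+ n)) (d n) ⟩
  + c (2 ℕ.+ n) + + d n                            ≡⟨ cong (_+_ (+ c (2 ℕ.+ n))) (X²⊛-suc-suc (toSeries d) n) ⟨
  + c (2 ℕ.+ n) + (X ^ˢ 2 ⊛ toSeries d) (2 ℕ.+ n)  ∎
  where open ≡-Reasoning

-- sumFrom and prodFrom are definitionally ∑.foldFrom and ∏.foldFrom.
module ∑ = UpToFold +-monoid
module ∏ = UpToFold *-monoid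

∑-⊛ : ∀ n F h → ∑.fold< n F ⊛ h ≈ ∑.fold< n (λ t → F t ⊛ h)
∑-⊛ n F h = foldr-map-⊛ (upTo n)
  where
  foldr-map-⊛ : ∀ xs → foldr _⊕_ 𝟘 (map F xs) ⊛ h ≈ foldr _⊕_ 𝟘 (map (λ t → F t ⊛ h) xs)
  foldr-map-⊛ []       = zeroˡ h
  foldr-map-⊛ (x ∷ xs) n =
    trans (distribʳ h (F x) (foldr _⊕_ 𝟘 (map F xs)) n) (cong (_+_ ((F x ⊛ h) n)) (foldr-map-⊛ xs n))

∑-toSeries : ∀ n (f : ℕ → ℕ → ℕ) m → ∑.fold< n (toSeries ∘ f) m ≡ + sumUpTo n (λ c → f c m)
∑-toSeries n f m = trans (cong (λ xs → foldr _⊕_ 𝟘 xs m) (map-upTo (toSeries ∘ f) n)) (go n f)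
  where
  go : ∀ n f → foldr _⊕_ 𝟘 (applyUpTo (toSeries ∘ f) n) m ≡ + sumUpTo n (λ c → f c m)
  go zero    f = 𝟘≡0 m
  go (suc n) f = trans (cong (_+_ (+ f 0 m)) (go n (f ∘ suc))) (sym (ℤ.pos-+ (f 0 m) _))

𝟙⊖X² : Series
𝟙⊖X² = 𝟙 ⊖ X ^ˢ 2

const-suc : ∀ n → const (+ n) ⊕ 𝟙 ≈ const (+ suc n)
const-suc n zero    = trans (sym (ℤ.pos-+ n 1)) (cong +_ (ℕ.+-comm n 1))
const-suc n (suc m) = refl

-- Counting words

count : ℕ → ℕ → (List ℕ → Bool) → ℕ
count zero    k Q = [ Q [] ]· 1
count (suc n) k Q = sumUpTo k (λ a → count n k (Q ∘ (a ∷_)))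

count-cong : ∀ n k {P Q} → (∀ w → P w ≡ Q w) → count n k P ≡ count n k Q
count-cong zero    k P≡Q = cong (λ b → [ b ]· 1) (P≡Q [])
count-cong (suc n) k P≡Q = sumUpTo-cong k (λ {a} _ → count-cong n k (P≡Q ∘ (a ∷_)))

count-false : ∀ n k → count n k (λ _ → false) ≡ 0
count-false zero    k = refl
count-false (suc n) k = trans (sumUpTo-cong k (λ _ → count-false n k)) (sumUpTo-zero k)

module _ {a b p} {A : Set a} {B : Set b} {P : Pred B p} (P? : Decidable P) where

  length-filter-map : ∀ (f : A → B) xs → length (filter P? (map f xs)) ≡ length (filter (P? ∘ f) xs)
  length-filter-map f []       = refl
  length-filter-map f (x ∷ xs) with does (P? (f x))
  ... | true  = cong suc (length-filter-map f xs)
  ... | false = length-filter-map f xs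

  length-filter-concatMap : ∀ (F : A → List B) xs →
    length (filter P? (concatMap F xs)) ≡ sum (map (length ∘ filter P? ∘ F) xs)
  length-filter-concatMap F []       = refl
  length-filter-concatMap F (x ∷ xs) = begin
    length (filter P? (F x ++ concatMap F xs))                  ≡⟨ cong length (filter-++ P? (F x) (concatMap F xs)) ⟩
    length (filter P? (F x) ++ filter P? (concatMap F xs))      ≡⟨ length-++ (filter P? (F x)) ⟩
    length (filter P? (F x)) ℕ.+ length (filter P? (concatMap F xs))
      ≡⟨ cong (ℕ._+_ (length (filter P? (F x)))) (length-filter-concatMap F xs) ⟩
    sum (map (length ∘ filter P? ∘ F) (x ∷ xs))                 ∎
    where open ≡-Reasoning

sum-allFin : ∀ n (h : ℕ → ℕ) → sum (map (h ∘ toℕ) (allFin n)) ≡ sumUpTo n h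
sum-allFin n h = trans (cong sum (map-tabulate {n = n} id (h ∘ toℕ))) (sum-tabulate n h)
  where
  sum-tabulate : ∀ n (h : ℕ → ℕ) → sum (tabulate (h ∘ toℕ {n})) ≡ sumUpTo n h
  sum-tabulate zero    h = refl
  sum-tabulate (suc n) h = cong (ℕ._+_ (h 0)) (sum-tabulate n (h ∘ suc))

count-allWords : ∀ n k (Q : List ℕ → Bool) →
  length (filter (λ w → T? (Q (map toℕ (toList w)))) (allWords n k)) ≡ count n k Q
count-allWords zero    k Q with Q []
... | true  = refl
... | false = refl
count-allWords (suc n) k Q = begin
  length (filter P? (concatMap (λ a → map (a ∷_) (allWords n k)) (allFin k)))
    ≡⟨ length-filter-concatMap P? (λ a → map (a ∷_) (allWords n k)) (allFin k) ⟩
  sum (map (λ a → length (filter P? (map (a ∷_) (allWords n k)))) (allFin k))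
    ≡⟨ cong sum (map-cong (λ a → trans (length-filter-map P? (a ∷_) (allWords n k))
                                        (count-allWords n k (Q ∘ (toℕ a ∷_)))) (allFin k)) ⟩
  sum (map (λ a → count n k (Q ∘ (toℕ a ∷_))) (allFin k))
    ≡⟨ sum-allFin k (λ a → count n k (Q ∘ (a ∷_))) ⟩
  count (suc n) k Q ∎
  where
  open ≡-Reasoning
  P? = λ w → T? (Q (map toℕ (toList w)))

avoids : List ℕ → Bool
avoids w = not (contains112-2 w)

a112-2≡count : ∀ n k → a112-2 n k ≡ count n k avoids
a112-2≡count n k = count-allWords n k avoids

contains-∷-≢ : ∀ {c y} w → c ≢ y → contains112-2 (c ∷ y ∷ w) ≡ contains112-2 (y ∷ w)
contains-∷-≢         []      _   = refl
contains-∷-≢ {c} {y} (z ∷ w) c≢y =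
  cong (λ b → b ∧ (c <ᵇ z) ∧ elemᵇ z w ∨ contains112-2 (y ∷ z ∷ w)) (≢⇒≡ᵇ-false c≢y)

contains-∷-∉ : ∀ y w → elemᵇ y w ≡ false → contains112-2 (y ∷ w) ≡ contains112-2 w
contains-∷-∉ y []          _   = refl
contains-∷-∉ y (z ∷ [])    _   = refl
contains-∷-∉ y (z ∷ u ∷ w) y∉w with y ≡ᵇ z
... | false = refl
... | true  with () ← y∉w

avoids-ascent : ∀ {c y} w → c < y → avoids (c ∷ c ∷ y ∷ w) ≡ not (elemᵇ y w) ∧ avoids w
avoids-ascent {c} {y} w c<y
  rewrite ≡ᵇ-refl c | <⇒<ᵇ-true c<y | contains-∷-≢ w (ℕ.<⇒≢ c<y) with elemᵇ y w in y∈w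
... | true  = refl
... | false = cong not (contains-∷-∉ y w y∈w)

punchIn-≡ᵇ : ∀ c a b → (punchIn c a ≡ᵇ punchIn c b) ≡ (a ≡ᵇ b)
punchIn-≡ᵇ zero    a       b       = refl
punchIn-≡ᵇ (suc c) zero    zero    = refl
punchIn-≡ᵇ (suc c) zero    (suc b) = refl
punchIn-≡ᵇ (suc c) (suc a) zero    = refl
punchIn-≡ᵇ (suc c) (suc a) (suc b) = punchIn-≡ᵇ c a b

punchIn-<ᵇ : ∀ c a b → (punchIn c a <ᵇ punchIn c b) ≡ (a <ᵇ b)
punchIn-<ᵇ zero    a       b       = refl
punchIn-<ᵇ (suc c) zero    zero    = refl
punchIn-<ᵇ (suc c) zero    (suc b) = refl
punchIn-<ᵇ (suc c) (suc a) zero    = refl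
punchIn-<ᵇ (suc c) (suc a) (suc b) = punchIn-<ᵇ c a b

punchIn-≢ᵇ : ∀ c i → (c ≡ᵇ punchIn c i) ≡ false
punchIn-≢ᵇ zero    i       = refl
punchIn-≢ᵇ (suc c) zero    = refl
punchIn-≢ᵇ (suc c) (suc i) = punchIn-≢ᵇ c i

elemᵇ-map-punchIn : ∀ c a w → elemᵇ (punchIn c a) (map (punchIn c) w) ≡ elemᵇ a w
elemᵇ-map-punchIn c a []      = refl
elemᵇ-map-punchIn c a (b ∷ w) = cong₂ _∨_ (punchIn-≡ᵇ c a b) (elemᵇ-map-punchIn c a w)

contains-map-punchIn : ∀ c w → contains112-2 (map (punchIn c) w) ≡ contains112-2 w
contains-map-punchIn c []              = refl
contains-map-punchIn c (a ∷ [])        = refl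
contains-map-punchIn c (a ∷ b ∷ [])    = refl
contains-map-punchIn c (a ∷ b ∷ d ∷ w) =
  cong₂ _∨_ (cong₂ _∧_ (punchIn-≡ᵇ c a b) (cong₂ _∧_ (punchIn-<ᵇ c a d) (elemᵇ-map-punchIn c d w)))
            (contains-map-punchIn c (b ∷ d ∷ w))

count-missing : ∀ m {k c} (Q : List ℕ → Bool) → c ≤ k →
  count m (suc k) (λ w → not (elemᵇ c w) ∧ Q w) ≡ count m k (Q ∘ map (punchIn c))
count-missing zero    Q _   = refl
count-missing (suc m) {k} {c} Q c≤k = begin
  sumUpTo (suc k) (λ a → count m (suc k) (λ w → not (elemᵇ c (a ∷ w)) ∧ Q (a ∷ w)))
    ≡⟨ sumUpTo-punchIn (λ a → count m (suc k) (λ w → not (elemᵇ c (a ∷ w)) ∧ Q (a ∷ w))) c≤k ⟩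
  count m (suc k) (λ w → not ((c ≡ᵇ c) ∨ elemᵇ c w) ∧ Q (c ∷ w))
    ℕ.+ sumUpTo k (λ i → count m (suc k) (λ w → not ((c ≡ᵇ punchIn c i) ∨ elemᵇ c w) ∧ Q (punchIn c i ∷ w)))
    ≡⟨ cong₂ ℕ._+_ letter-c (sumUpTo-cong k (λ {i} _ → other-letter i)) ⟩
  0 ℕ.+ count (suc m) k (Q ∘ map (punchIn c))
    ∎
  where
  open ≡-Reasoning
  letter-c : count m (suc k) (λ w → not ((c ≡ᵇ c) ∨ elemᵇ c w) ∧ Q (c ∷ w)) ≡ 0
  letter-c = trans (count-cong m (suc k) (λ w → cong (λ b → not (b ∨ elemᵇ c w) ∧ Q (c ∷ w)) (≡ᵇ-refl c)))
                   (count-false m (suc k))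
  other-letter : ∀ i → count m (suc k) (λ w → not ((c ≡ᵇ punchIn c i) ∨ elemᵇ c w) ∧ Q (punchIn c i ∷ w))
                     ≡ count m k (λ w → Q (punchIn c i ∷ map (punchIn c) w))
  other-letter i =
    trans (count-cong m (suc k) (λ w → cong (λ b → not (b ∨ elemᵇ c w) ∧ Q (punchIn c i ∷ w)) (punchIn-≢ᵇ c i)))
          (count-missing m (Q ∘ (punchIn c i ∷_)) c≤k)

count-avoids-missing : ∀ m {k c} → c ≤ k →
  count m (suc k) (λ w → not (elemᵇ c w) ∧ avoids w) ≡ count m k avoids
count-avoids-missing m {k} {c} c≤k =
  trans (count-missing m avoids c≤k) (count-cong m k (λ w → cong not (contains-map-punchIn c w)))

-- The recurrence for W(x;k+1)

module Recurrence (k : ℕ) where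

  K : ℕ
  K = suc k

  A A′ : ℕ → ℕ
  A  m = count m K avoids
  A′ m = count m k avoids

  R : ℕ → ℕ → ℕ
  R c m = count m K (λ w → avoids (c ∷ w))

  above : ℕ → (ℕ → ℕ) → ℕ
  above c g = sumUpTo K (λ y → [ c <ᵇ y ]· g y)

  above-suc : ∀ {c} g → suc c < K → above c g ≡ g (suc c) ℕ.+ above (suc c) g
  above-suc {c} g 1+c<K = begin
    above c g
      ≡⟨ sumUpTo-cong K (λ {y} _ → [<ᵇ]·-split c y (g y)) ⟩
    sumUpTo K (λ y → [ suc c ≡ᵇ y ]· g y ℕ.+ [ suc c <ᵇ y ]· g y)
      ≡⟨ sumUpTo-+ K (λ y → [ suc c ≡ᵇ y ]· g y) (λ y → [ suc c <ᵇ y ]· g y) ⟩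
    sumUpTo K (λ y → [ suc c ≡ᵇ y ]· g y) ℕ.+ above (suc c) g
      ≡⟨ cong (ℕ._+ above (suc c) g) (sumUpTo-δ g 1+c<K) ⟩
    g (suc c) ℕ.+ above (suc c) g ∎
    where open ≡-Reasoning

  above-top : ∀ g → above k g ≡ 0
  above-top g =
    trans (sumUpTo-cong K (λ {y} y<K → cong (λ b → [ b ]· g y) (≮⇒<ᵇ-false (ℕ.≤⇒≯ (ℕ.s≤s⁻¹ y<K)))))
          (sumUpTo-zero K)

  prepend : ∀ m c x y → y < K →
    count m K (λ w → avoids (c ∷ x ∷ y ∷ w)) ℕ.+ [ c ≡ᵇ x ]· [ c <ᵇ y ]· R y m
      ≡ count m K (λ w → avoids (x ∷ y ∷ w)) ℕ.+ [ c ≡ᵇ x ]· [ c <ᵇ y ]· A′ m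
  prepend m c x y y<K with c ℕ.≟ x
  ... | no c≢x rewrite ≢⇒≡ᵇ-false c≢x = refl
  ... | yes refl with c ℕ.<? y
  ...   | no c≮y rewrite ≡ᵇ-refl c | ≮⇒<ᵇ-false c≮y = refl
  ...   | yes c<y = begin
    count m K (λ w → avoids (c ∷ c ∷ y ∷ w)) ℕ.+ [ c ≡ᵇ c ]· [ c <ᵇ y ]· R y m
      ≡⟨ cong₂ ℕ._+_ (count-cong m K (λ w → avoids-ascent w c<y)) (ascent (R y m)) ⟩
    count m K (λ w → not (elemᵇ y w) ∧ avoids w) ℕ.+ R y m
      ≡⟨ cong (ℕ._+ R y m) (count-avoids-missing m (ℕ.s≤s⁻¹ y<K)) ⟩
    A′ m ℕ.+ R y m
      ≡⟨ ℕ.+-comm (A′ m) (R y m) ⟩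
    R y m ℕ.+ A′ m
      ≡⟨ cong₂ ℕ._+_ (count-cong m K (λ w → cong not (contains-∷-≢ w (ℕ.<⇒≢ c<y)))) (ascent (A′ m)) ⟨
    count m K (λ w → avoids (c ∷ y ∷ w)) ℕ.+ [ c ≡ᵇ c ]· [ c <ᵇ y ]· A′ m ∎
    where
    open ≡-Reasoning
    ascent : ∀ v → [ c ≡ᵇ c ]· [ c <ᵇ y ]· v ≡ v
    ascent v = cong₂ (λ a b → [ a ]· [ b ]· v) (≡ᵇ-refl c) (<⇒<ᵇ-true c<y)

  R-recurrence : ∀ m {c} → c < K →
    R c (2 ℕ.+ m) ℕ.+ above c (λ y → R y m) ≡ A (2 ℕ.+ m) ℕ.+ above c (λ _ → A′ m)
  R-recurrence m {c} c<K = begin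
    R c (2 ℕ.+ m) ℕ.+ above c (λ y → R y m)
      ≡⟨ sumUpTo²-δ K (λ x y → count m K (λ w → avoids (c ∷ x ∷ y ∷ w))) (λ y → [ c <ᵇ y ]· R y m) c<K ⟨
    sumUpTo K (λ x → sumUpTo K (λ y →
      count m K (λ w → avoids (c ∷ x ∷ y ∷ w)) ℕ.+ [ c ≡ᵇ x ]· [ c <ᵇ y ]· R y m))
      ≡⟨ sumUpTo-cong K (λ {x} _ → sumUpTo-cong K (λ {y} y<K → prepend m c x y y<K)) ⟩
    sumUpTo K (λ x → sumUpTo K (λ y →
      count m K (λ w → avoids (x ∷ y ∷ w)) ℕ.+ [ c ≡ᵇ x ]· [ c <ᵇ y ]· A′ m))
      ≡⟨ sumUpTo²-δ K (λ x y → count m K (λ w → avoids (x ∷ y ∷ w))) (λ y → [ c <ᵇ y ]· A′ m) c<K ⟩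
    A (2 ℕ.+ m) ℕ.+ above c (λ _ → A′ m) ∎
    where open ≡-Reasoning

  R-step : ∀ m {c} → suc c < K → R c (2 ℕ.+ m) ℕ.+ R (suc c) m ≡ R (suc c) (2 ℕ.+ m) ℕ.+ A′ m
  R-step m {c} 1+c<K = ℕ.+-cancelʳ-≡ S _ _ (begin
    (R c (2 ℕ.+ m) ℕ.+ R (suc c) m) ℕ.+ S      ≡⟨ ℕ.+-assoc (R c (2 ℕ.+ m)) (R (suc c) m) S ⟩
    R c (2 ℕ.+ m) ℕ.+ (R (suc c) m ℕ.+ S)      ≡⟨ cong (ℕ._+_ (R c (2 ℕ.+ m))) (above-suc (λ y → R y m) 1+c<K) ⟨
    R c (2 ℕ.+ m) ℕ.+ above c (λ y → R y m)    ≡⟨ R-recurrence m (ℕ.<-trans (ℕ.n<1+n c) 1+c<K) ⟩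
    A (2 ℕ.+ m) ℕ.+ above c (λ _ → A′ m)       ≡⟨ cong (ℕ._+_ (A (2 ℕ.+ m))) (above-suc (λ _ → A′ m) 1+c<K) ⟩
    A (2 ℕ.+ m) ℕ.+ (A′ m ℕ.+ S′)              ≡⟨ x∙yz≈xz∙y (A (2 ℕ.+ m)) (A′ m) S′ ⟩
    (A (2 ℕ.+ m) ℕ.+ S′) ℕ.+ A′ m              ≡⟨ cong (ℕ._+ A′ m) (R-recurrence m 1+c<K) ⟨
    (R (suc c) (2 ℕ.+ m) ℕ.+ S) ℕ.+ A′ m       ≡⟨ xy∙z≈xz∙y (R (suc c) (2 ℕ.+ m)) S (A′ m) ⟩
    (R (suc c) (2 ℕ.+ m) ℕ.+ A′ m) ℕ.+ S       ∎)
    where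
    open ≡-Reasoning
    open import Algebra.Properties.CommutativeSemigroup ℕ.+-commutativeSemigroup using (x∙yz≈xz∙y; xy∙z≈xz∙y)
    S S′ : ℕ
    S  = above (suc c) (λ y → R y m)
    S′ = above (suc c) (λ _ → A′ m)

  R-top : ∀ m → R k m ≡ A m
  R-top zero          = refl
  R-top (suc zero)    = refl
  R-top (suc (suc m)) = begin
    R k (2 ℕ.+ m)                                ≡⟨ ℕ.+-identityʳ (R k (2 ℕ.+ m)) ⟨
    R k (2 ℕ.+ m) ℕ.+ 0                          ≡⟨ cong (ℕ._+_ (R k (2 ℕ.+ m))) (above-top (λ y → R y m)) ⟨
    R k (2 ℕ.+ m) ℕ.+ above k (λ y → R y m)      ≡⟨ R-recurrence m (ℕ.n<1+n k) ⟩
    A (2 ℕ.+ m) ℕ.+ above k (λ _ → A′ m)         ≡⟨ cong (ℕ._+_ (A (2 ℕ.+ m))) (above-top (λ _ → A′ m)) ⟩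
    A (2 ℕ.+ m) ℕ.+ 0                            ≡⟨ ℕ.+-identityʳ (A (2 ℕ.+ m)) ⟩
    A (2 ℕ.+ m)                                  ∎
    where open ≡-Reasoning

  Aˢ A′ˢ : Series
  Aˢ  = toSeries A
  A′ˢ = toSeries A′

  Rˢ : ℕ → Series
  Rˢ c = toSeries (R c)

  -- R c 0 and R c 1 do not depend on c: words of length at most 2 avoid 112-2.
  Rˢ-step : ∀ {c} → suc c < K → Rˢ c ⊕ X ^ˢ 2 ⊛ Rˢ (suc c) ≈ Rˢ (suc c) ⊕ X ^ˢ 2 ⊛ A′ˢ
  Rˢ-step 1+c<K = toSeries-X²-recurrence refl refl (λ m → R-step m 1+c<K)

  Rˢ-closed : ∀ d {c} → c ℕ.+ d ≡ k → Rˢ c ⊖ A′ˢ ≈ 𝟙⊖X² ^ˢ d ⊛ (Aˢ ⊖ A′ˢ)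
  Rˢ-closed zero {c} c+0≡k = begin
    Rˢ c ⊖ A′ˢ      ≈⟨ ⊖-cong Rˢc≈Aˢ (≈-refl {A′ˢ}) ⟩
    Aˢ ⊖ A′ˢ        ≈⟨ *-identityˡ (Aˢ ⊖ A′ˢ) ⟨
    𝟙 ⊛ (Aˢ ⊖ A′ˢ)  ∎
    where
    open ≈-Reasoning
    Rˢc≈Aˢ : Rˢ c ≈ Aˢ
    Rˢc≈Aˢ m = cong +_ (subst (λ c → R c m ≡ A m) (trans (sym c+0≡k) (ℕ.+-identityʳ c)) (R-top m))
  Rˢ-closed (suc d) {c} c+1+d≡k = begin
    Rˢ c ⊖ A′ˢ
      ≈⟨ solve 4 (λ r r′ a x → r :- a
                                := (r :+ x :^ 2 :* r′) :- (r′ :+ x :^ 2 :* a) :+ (con (+ 1) :- x :^ 2) :* (r′ :- a))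
                 (λ _ → refl) (Rˢ c) (Rˢ (suc c)) A′ˢ X ⟩
    (Rˢ c ⊕ X ^ˢ 2 ⊛ Rˢ (suc c)) ⊖ (Rˢ (suc c) ⊕ X ^ˢ 2 ⊛ A′ˢ) ⊕ 𝟙⊖X² ⊛ (Rˢ (suc c) ⊖ A′ˢ)
      ≈⟨ ⊕-cong (⊖-cong (Rˢ-step 1+c<K) (≈-refl {V})) (⊛-cong (≈-refl {𝟙⊖X²}) (Rˢ-closed d 1+c+d≡k)) ⟩
    V ⊖ V ⊕ 𝟙⊖X² ⊛ (𝟙⊖X² ^ˢ d ⊛ (Aˢ ⊖ A′ˢ))
      ≈⟨ solve 4 (λ v z zd e → v :- v :+ z :* (zd :* e) := z :* zd :* e)
                 (λ _ → refl) V 𝟙⊖X² (𝟙⊖X² ^ˢ d) (Aˢ ⊖ A′ˢ) ⟩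
    𝟙⊖X² ^ˢ suc d ⊛ (Aˢ ⊖ A′ˢ) ∎
    where
    open ≈-Reasoning
    V : Series
    V = Rˢ (suc c) ⊕ X ^ˢ 2 ⊛ A′ˢ
    1+c+d≡k : suc c ℕ.+ d ≡ k
    1+c+d≡k = trans (sym (ℕ.+-suc c d)) c+1+d≡k
    1+c<K : suc c < K
    1+c<K = s≤s (subst (suc c ≤_) 1+c+d≡k (ℕ.m≤m+n (suc c) d))

  Aˢ-first-letter : Aˢ ≈ 𝟙 ⊕ X ⊛ ∑.fold< K Rˢ
  Aˢ-first-letter zero    = sym (cong (_+_ (+ 1)) (X⊛-zero (∑.fold< K Rˢ)))
  Aˢ-first-letter (suc m) =
    sym (trans (ℤ.+-identityˡ _) (trans (X⊛-suc (∑.fold< K Rˢ) m) (∑-toSeries K R m)))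

  X²⊛∑Rˢ : ∀ n {e} → n ℕ.+ e ≡ K →
    X ^ˢ 2 ⊛ ∑.fold< n Rˢ
      ≈ (𝟙⊖X² ^ˢ e ⊖ 𝟙⊖X² ^ˢ K) ⊛ (Aˢ ⊖ A′ˢ) ⊕ const (+ n) ⊛ X ^ˢ 2 ⊛ A′ˢ
  X²⊛∑Rˢ zero    refl =
    solve 4 (λ x zK e a′ → x :^ 2 :* con (+ 0) := (zK :- zK) :* e :+ con (+ 0) :* x :^ 2 :* a′)
          (λ _ → refl) X (𝟙⊖X² ^ˢ K) (Aˢ ⊖ A′ˢ) A′ˢ
  X²⊛∑Rˢ (suc n) {e} 1+n+e≡K = begin
    X ^ˢ 2 ⊛ ∑.fold< (suc n) Rˢ
      ≈⟨ ⊛-cong (≈-refl {X ^ˢ 2}) (∑.fold<-suc n Rˢ) ⟩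
    X ^ˢ 2 ⊛ (∑.fold< n Rˢ ⊕ Rˢ n)
      ≈⟨ solve 4 (λ x s r a′ → x :^ 2 :* (s :+ r) := x :^ 2 :* s :+ x :^ 2 :* (r :- a′) :+ x :^ 2 :* a′)
                 (λ _ → refl) X (∑.fold< n Rˢ) (Rˢ n) A′ˢ ⟩
    X ^ˢ 2 ⊛ ∑.fold< n Rˢ ⊕ X ^ˢ 2 ⊛ (Rˢ n ⊖ A′ˢ) ⊕ X ^ˢ 2 ⊛ A′ˢ
      ≈⟨ ⊕-cong (⊕-cong (X²⊛∑Rˢ n (trans (ℕ.+-suc n e) 1+n+e≡K))
                        (⊛-cong (≈-refl {X ^ˢ 2}) (Rˢ-closed e (ℕ.suc-injective 1+n+e≡K))))
                (≈-refl {X ^ˢ 2 ⊛ A′ˢ}) ⟩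
    (𝟙⊖X² ^ˢ suc e ⊖ 𝟙⊖X² ^ˢ K) ⊛ E ⊕ const (+ n) ⊛ X ^ˢ 2 ⊛ A′ˢ
      ⊕ X ^ˢ 2 ⊛ (𝟙⊖X² ^ˢ e ⊛ E) ⊕ X ^ˢ 2 ⊛ A′ˢ
      ≈⟨ solve 6 (λ x ze zK e cn a′ →
                    ((con (+ 1) :- x :^ 2) :* ze :- zK) :* e :+ cn :* x :^ 2 :* a′ :+ x :^ 2 :* (ze :* e) :+ x :^ 2 :* a′
                    := (ze :- zK) :* e :+ (cn :+ con (+ 1)) :* x :^ 2 :* a′)
                 (λ _ → refl) X (𝟙⊖X² ^ˢ e) (𝟙⊖X² ^ˢ K) E (const (+ n)) A′ˢ ⟩
    (𝟙⊖X² ^ˢ e ⊖ 𝟙⊖X² ^ˢ K) ⊛ E ⊕ (const (+ n) ⊕ 𝟙) ⊛ X ^ˢ 2 ⊛ A′ˢ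
      ≈⟨ ⊕-cong (≈-refl {(𝟙⊖X² ^ˢ e ⊖ 𝟙⊖X² ^ˢ K) ⊛ E})
                (⊛-cong (⊛-cong (const-suc n) (≈-refl {X ^ˢ 2})) (≈-refl {A′ˢ})) ⟩
    (𝟙⊖X² ^ˢ e ⊖ 𝟙⊖X² ^ˢ K) ⊛ E ⊕ const (+ suc n) ⊛ X ^ˢ 2 ⊛ A′ˢ ∎
    where
    open ≈-Reasoning
    E : Series
    E = Aˢ ⊖ A′ˢ

  Aˢ-recurrence : Aˢ ⊛ D K ≈ X ⊕ N K ⊛ A′ˢ
  Aˢ-recurrence = begin
    Aˢ ⊛ D K
      ≈⟨ solve 6 (λ a s zK cK a′ x →
                    a :* (zK :- con (+ 1) :+ x)
                    := (x :+ (cK :* x :^ 2 :- con (+ 1) :+ zK) :* a′)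
                       :+ (x :* (a :- (con (+ 1) :+ x :* s))
                           :+ (x :^ 2 :* s :- ((con (+ 1) :- zK) :* (a :- a′) :+ cK :* x :^ 2 :* a′))))
                 (λ _ → refl) Aˢ S (𝟙⊖X² ^ˢ K) (const (+ K)) A′ˢ X ⟩
    (X ⊕ N K ⊛ A′ˢ) ⊕ (X ⊛ (Aˢ ⊖ B) ⊕ (X ^ˢ 2 ⊛ S ⊖ T))
      ≈⟨ ⊕-cong (≈-refl {X ⊕ N K ⊛ A′ˢ}) (⊕-cong (⊛-cong (≈-refl {X}) (⊖-cong Aˢ-first-letter (≈-refl {B})))
                                                (⊖-cong (X²⊛∑Rˢ K (ℕ.+-identityʳ K)) (≈-refl {T}))) ⟩
    (X ⊕ N K ⊛ A′ˢ) ⊕ (X ⊛ (B ⊖ B) ⊕ (T ⊖ T))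
      ≈⟨ solve 4 (λ y x b t → y :+ (x :* (b :- b) :+ (t :- t)) := y) (λ _ → refl) (X ⊕ N K ⊛ A′ˢ) X B T ⟩
    X ⊕ N K ⊛ A′ˢ ∎
    where
    open ≈-Reasoning
    S B T : Series
    S = ∑.fold< K Rˢ
    B = 𝟙 ⊕ X ⊛ S
    T = (𝟙 ⊖ 𝟙⊖X² ^ˢ K) ⊛ (Aˢ ⊖ A′ˢ) ⊕ const (+ K) ⊛ X ^ˢ 2 ⊛ A′ˢ

-- The product formula

W≈count : ∀ k → W112-2 k ≈ toSeries (λ n → count n k avoids)
W≈count k n = cong +_ (a112-2≡count n k)

W-zero : W112-2 0 ≈ 𝟙
W-zero zero    = refl
W-zero (suc n) = refl

W-recurrence : ∀ k → W112-2 (suc k) ⊛ D (suc k) ≈ X ⊕ N (suc k) ⊛ W112-2 k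
W-recurrence k = begin
  W112-2 (suc k) ⊛ D (suc k)  ≈⟨ ⊛-cong (W≈count (suc k)) (≈-refl {D (suc k)}) ⟩
  Aˢ ⊛ D (suc k)              ≈⟨ Aˢ-recurrence ⟩
  X ⊕ N (suc k) ⊛ A′ˢ         ≈⟨ ⊕-cong (≈-refl {X}) (⊛-cong (≈-refl {N (suc k)}) (≈-sym (W≈count k))) ⟩
  X ⊕ N (suc k) ⊛ W112-2 k    ∎
  where
  open Recurrence k
  open ≈-Reasoning

N-one : N 1 ≈ 𝟘
N-one = solve 1 (λ x → con (+ 1) :* x :^ 2 :- con (+ 1) :+ (con (+ 1) :- x :^ 2) :^ 1 := con (+ 0)) (λ _ → refl) X

term : ℕ → ℕ → Series
term k j = X ⊛ prodFrom 1 (j ∸ 1) D ⊛ prodFrom (suc j) k N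

term-suc : ∀ {k j} → j < k → term k (suc j) ⊛ N (suc k) ≈ term (suc k) (suc j)
term-suc {k} {j} j<k = begin
  X ⊛ P ⊛ prodFrom (2 ℕ.+ j) k N ⊛ N (suc k)    ≈⟨ *-assoc (X ⊛ P) (prodFrom (2 ℕ.+ j) k N) (N (suc k)) ⟩
  X ⊛ P ⊛ (prodFrom (2 ℕ.+ j) k N ⊛ N (suc k))
    ≈⟨ ⊛-cong (≈-refl {X ⊛ P}) (∏.foldFrom-suc (2 ℕ.+ j) k N (s≤s j<k)) ⟨
  X ⊛ P ⊛ prodFrom (2 ℕ.+ j) (suc k) N          ∎
  where
  open ≈-Reasoning
  P : Series
  P = prodFrom 1 j D

-- The last summand vanishes for k ≥ 1 since N 1 = 0; keeping it makes the base case k = 0 hold.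
W⊛prodD : ∀ k → W112-2 k ⊛ prodFrom 1 k D ≈ sumFrom 1 k (term k) ⊕ prodFrom 1 k N
W⊛prodD zero = begin
  W112-2 0 ⊛ 𝟙  ≈⟨ *-identityʳ (W112-2 0) ⟩
  W112-2 0      ≈⟨ W-zero ⟩
  𝟙             ≈⟨ +-identityˡ 𝟙 ⟨
  𝟘 ⊕ 𝟙         ∎
  where open ≈-Reasoning
W⊛prodD (suc k) = begin
  W′ ⊛ prodFrom 1 (suc k) D
    ≈⟨ ⊛-cong (≈-refl {W′}) (∏.foldFrom-suc 1 k D (s≤s z≤n)) ⟩
  W′ ⊛ (PD ⊛ D (suc k))
    ≈⟨ solve 3 (λ w p d → w :* (p :* d) := w :* d :* p) (λ _ → refl) W′ PD (D (suc k)) ⟩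
  W′ ⊛ D (suc k) ⊛ PD
    ≈⟨ ⊛-cong (W-recurrence k) (≈-refl {PD}) ⟩
  (X ⊕ N (suc k) ⊛ W112-2 k) ⊛ PD
    ≈⟨ solve 4 (λ x n w p → (x :+ n :* w) :* p := x :* p :+ w :* p :* n)
               (λ _ → refl) X (N (suc k)) (W112-2 k) PD ⟩
  X ⊛ PD ⊕ W112-2 k ⊛ PD ⊛ N (suc k)
    ≈⟨ ⊕-cong (≈-refl {X ⊛ PD}) (⊛-cong (W⊛prodD k) (≈-refl {N (suc k)})) ⟩
  X ⊛ PD ⊕ (sumFrom 1 k (term k) ⊕ PN) ⊛ N (suc k)
    ≈⟨ ⊕-cong (≈-refl {X ⊛ PD}) (distribʳ (N (suc k)) (sumFrom 1 k (term k)) PN) ⟩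
  X ⊛ PD ⊕ (sumFrom 1 k (term k) ⊛ N (suc k) ⊕ PN ⊛ N (suc k))
    ≈⟨ ⊕-cong last-term (⊕-cong earlier-terms (≈-sym (∏.foldFrom-suc 1 k N (s≤s z≤n)))) ⟩
  term (suc k) (suc k) ⊕ (sumFrom 1 k (term (suc k)) ⊕ prodFrom 1 (suc k) N)
    ≈⟨ solve 3 (λ a b c → a :+ (b :+ c) := b :+ a :+ c) (λ _ → refl)
               (term (suc k) (suc k)) (sumFrom 1 k (term (suc k))) (prodFrom 1 (suc k) N) ⟩
  sumFrom 1 k (term (suc k)) ⊕ term (suc k) (suc k) ⊕ prodFrom 1 (suc k) N
    ≈⟨ ⊕-cong (≈-sym (∑.foldFrom-suc 1 k (term (suc k)) (s≤s z≤n))) (≈-refl {prodFrom 1 (suc k) N}) ⟩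
  sumFrom 1 (suc k) (term (suc k)) ⊕ prodFrom 1 (suc k) N ∎
  where
  open ≈-Reasoning
  W′ PD PN : Series
  W′ = W112-2 (suc k)
  PD = prodFrom 1 k D
  PN = prodFrom 1 k N
  last-term : X ⊛ PD ≈ term (suc k) (suc k)
  last-term = ≈-trans (≈-sym (*-identityʳ (X ⊛ PD)))
                      (⊛-cong (≈-refl {X ⊛ PD}) (≈-sym (∏.foldFrom-empty (suc k) N)))
  earlier-terms : sumFrom 1 k (term k) ⊛ N (suc k) ≈ sumFrom 1 k (term (suc k))
  earlier-terms = ≈-trans (∑-⊛ k (term k ∘ suc) (N (suc k))) (∑.fold<-cong k term-suc)

prodFrom-N≈𝟘 : ∀ k → prodFrom 1 (suc k) N ≈ 𝟘
prodFrom-N≈𝟘 k = ≈-trans (∏.foldFrom-suc 1 k N (s≤s z≤n)) (last-factor k)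
  where
  last-factor : ∀ k → prodFrom 1 k N ⊛ N (suc k) ≈ 𝟘
  last-factor zero    = ≈-trans (⊛-cong (≈-refl {𝟙}) N-one) (zeroʳ 𝟙)
  last-factor (suc k) = ≈-trans (⊛-cong (prodFrom-N≈𝟘 k) (≈-refl {N (2 ℕ.+ k)})) (zeroˡ (N (2 ℕ.+ k)))

theorem4p4 : (k : ℕ) → 1 ≤ k → (n : ℕ) →
    (W112-2 k ⊛ prodFrom 1 k D) n
    ≡ sumFrom 1 k (λ j → X ⊛ prodFrom 1 (j ∸ 1) D ⊛ prodFrom (suc j) k N) n
theorem4p4 (suc k) _ = begin
  W112-2 (suc k) ⊛ prodFrom 1 (suc k) D                    ≈⟨ W⊛prodD (suc k) ⟩
  sumFrom 1 (suc k) (term (suc k)) ⊕ prodFrom 1 (suc k) N  ≈⟨ ⊕-cong (≈-refl {Σ}) (prodFrom-N≈𝟘 k) ⟩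
  sumFrom 1 (suc k) (term (suc k)) ⊕ 𝟘                     ≈⟨ +-identityʳ Σ ⟩
  sumFrom 1 (suc k) (term (suc k))                         ∎
  where
  open ≈-Reasoning
  Σ : Series
  Σ = sumFrom 1 (suc k) (term (suc k))
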